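{- Let $M_3$ be the Turing machine with states $A,B$ (plus the halting state $H$), symbols $0,1,2,3,4$ ($0$ blank) and transition table $\delta(A,0)=(1,R,B)$, $\delta(A,1)=(2,L,A)$, $\delta(A,2)=(1,R,A)$, $\delta(A,3)=(2,L,B)$, $\delta(A,4)=(2,L,A)$; $\delta(B,0)=(0,L,A)$, $\delta(B,1)=(2,R,B)$, $\delta(B,2)=(3,R,B)$, $\delta(B,3)=(4,R,A)$, $\delta(B,4)=(1,R,H)$. For $n\ge 0$ define $C(n,1) = {}^\omega 0\,1\,3^n(B0)0^\omega$, $C(n,2) = {}^\omega 0\,2\,3^n(B0)0^\omega$, $C(n,3) = {}^\omega 0\,3^n(B0)0^\omega$, $C(n,4) = {}^\omega 0\,4\,1\,1\,3^n(B0)0^\omega$, $C(n,5) = {}^\omega 0\,4\,1\,2\,3^n(B0)0^\omega$, $C(n,6) = {}^\omega 0\,4\,1\,3^n(B0)0^\omega$, $C(n,7) = {}^\omega 0\,4\,2\,3^n(B0)0^\omega$, $C(n,8) = {}^\omega 0\,4\,3^n(B0)0^\omega$. Then (a) ${}^\omega 0(A0)0^\omega \vdash(1)\ C(0,1)$, and, for all integers $k\ge 0$: (b) $C(2k,1) \vdash(3k^2+8k+4)\ C(3k+1,1)$; (c) $C(2k,2) \vdash(3k^2+14k+9)\ C(3k+2,1)$; (d) $C(2k,3) \vdash(3k^2+8k+2)\ C(3k,1)$; (e) $C(2k,4) \vdash(3k^2+8k+8)\ C(3k+3,1)$; (f) $C(2k,5) \vdash(3k^2+14k+13)\ C(3k+4,1)$;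 (g) $C(2k,6) \vdash(3k^2+8k+6)\ C(3k+2,1)$; (h) $C(2k,7) \vdash(3k^2+14k+11)\ C(3k+3,1)$; (i) $C(2k,8) \vdash(3k^2+8k+4)\ C(3k+1,1)$; (j) $C(2k+1,1) \vdash(3k^2+8k+4)\ C(3k+1,2)$; (k) $C(2k+1,2) \vdash(3k^2+8k+4)\ C(3k+2,3)$; (l) $C(2k+1,3) \vdash(3k^2+8k+22)\ C(3k+1,4)$; (m) $C(2k+1,4) \vdash(3k^2+8k+4)\ C(3k+1,5)$; (n) $C(2k+1,5) \vdash(3k^2+8k+4)\ C(3k+2,6)$; (o) $C(2k+1,6) \vdash(3k^2+8k+4)\ C(3k+1,7)$; (p) $C(2k+1,7) \vdash(3k^2+8k+4)\ C(3k+2,8)$; (q) $C(2k+1,8) \vdash(3k^2+5k+3)\ {}^\omega 0\,1\,(H2)\,2^{3k}\,0^\omega$.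
   Context: Turing machines here have one tape, infinite in both directions. $\delta(q,a)=(b,D,q')$ means: in state $q$ reading symbol $a$, the machine writes $b$ on the current cell, moves the head one cell left ($D=L$) or right ($D=R$), and enters state $q'$. When the machine enters the halting state $H$ it stops. A configuration is written ${}^\omega 0\, x\,(S a)\, y\, 0^\omega$, where $x,y$ are finite words: the tape contains the word $xay$ surrounded on both sides by infinitely many $0$'s, the machine is in state $S$, and the head scans the cell containing the displayed symbol $a$. Each digit is one tape symbol; $w^n$ denotes the concatenation of $n$ copies of $w$ (an exponent applies to the single preceding symbol unless parentheses are used), $w^0$ is empty. $C_1 \vdash(t)\ C_2$ means that the machine, started in configuration $C_1$, is in configuration $C_2$ after exactly $t$ steps. -}

module Defs where

open import Data.Nat using (ℕ; zero; suc)
open import Data.List using (List; []; _∷_; _++_; reverse; replicate)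
open import Data.Maybe using (Maybe; just; nothing; _>>=_)
open import Data.Product using (_×_; _,_)
open import Relation.Binary.PropositionalEquality using (_≡_)

data Sym : Set where
  s0 s1 s2 s3 s4 : Sym

data Dir : Set where
  L R : Dir

data St : Set where
  A B H : St

-- A configuration: cells to the left of the head (nearest first),
-- the state, the scanned symbol, cells to the right (nearest first).
-- All other cells are blank (s0).
record Config : Set where
  constructor cfg
  field
    left  : List Sym
    state : St
    head  : Sym
    right : List Sym

δ : St → Sym → Maybe (Sym × Dir × St)
δ A s0 = just (s1 , R , B)
δ A s1 = just (s2 , L , A)
δ A s2 = just (s1 , R , A)
δ A s3 = just (s2 , L , B)
δ A s4 = just (s2 , L , A)
δ B s0 = just (s0 , L , A)
δ B s1 = just (s2 , R , B)
δ B s2 = just (s3 , R , B)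
δ B s3 = just (s4 , R , A)
δ B s4 = just (s1 , R , H)
δ H _  = nothing

move : Sym → Dir → St → List Sym → List Sym → Config
move b L q []       r = cfg [] q s0 (b ∷ r)
move b L q (x ∷ l)  r = cfg l  q x  (b ∷ r)
move b R q l []       = cfg (b ∷ l) q s0 []
move b R q l (x ∷ r)  = cfg (b ∷ l) q x  r

step : Config → Maybe Config
step (cfg l q a r) with δ q a
... | nothing            = nothing
... | just (b , d , q')  = just (move b d q' l r)

run : ℕ → Config → Maybe Config
run zero    c = just c
run (suc t) c = step c >>= run t

strip : List Sym → List Sym
strip []      = []
strip (x ∷ xs) with x | strip xs
... | s0 | []   = []
... | y  | ys   = y ∷ ys

normalize : Config → Config
normalize (cfg l q a r) = cfg (strip l) q a (strip r)

_≈c_ : Config → Config → Set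
c ≈c d = normalize c ≡ normalize d

_⊢⟨_⟩_ : Config → ℕ → Config → Set
c ⊢⟨ t ⟩ d = Data.Maybe.map normalize (run t c) ≡ just (normalize d)
  where import Data.Maybe

-- The configuration  ω0 x (S a) y 0ω  (x, y written left to right).
conf : List Sym → St → Sym → List Sym → Config
conf x q a y = cfg (reverse x) q a y

-- C(n,i) for i = 1..8 (other i: unused junk value).
C : ℕ → ℕ → Config
C n 1 = conf (s1 ∷ replicate n s3) B s0 []
C n 2 = conf (s2 ∷ replicate n s3) B s0 []
C n 3 = conf (replicate n s3) B s0 []
C n 4 = conf (s4 ∷ s1 ∷ s1 ∷ replicate n s3) B s0 []
C n 5 = conf (s4 ∷ s1 ∷ s2 ∷ replicate n s3) B s0 []
C n 6 = conf (s4 ∷ s1 ∷ replicate n s3) B s0 []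
C n 7 = conf (s4 ∷ s2 ∷ replicate n s3) B s0 []
C n 8 = conf (s4 ∷ replicate n s3) B s0 []
C n _ = conf [] B s0 []

-- From C(n,i) the machine turns left into the block of 3s and eats it two
-- cells at a time from the right: each pair of 3s becomes three 2s, appended
-- to a block of 2s growing to the right, and every pair costs one round trip
-- across that block, which is where the quadratic running time comes from.
-- Thus 2k threes become 3k twos in 3k² + 5k + 1 steps, the head ending in
-- state A on the cell left of the original block.  What happens next depends
-- only on the short prefix of C(n,i) (and on the leftover 3 when n is odd):
-- after a few steps the machine either halts or enters state B at the left end
-- of the 2s and sweeps right, turning them into 3s, which yields the next C.
module Submission where

open import Defs
open import Data.Nat using (ℕ; zero; suc; _+_; _*_)
open import Data.Nat.Properties using (*-suc; +-comm)
open import Data.List using (List; []; _∷_; _++_; replicate; reverse)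
open import Data.List.Properties using (reverse-++; unfold-reverse; ++-identityʳ)
open import Data.Maybe using (just; nothing; _>>=_; map)
open import Data.Product using (_×_; _,_)
open import Relation.Binary.PropositionalEquality
open import Data.Nat.Tactic.RingSolver using (solve; solve-∀)

replicate-++-∷ : ∀ {A : Set} n (a : A) xs → replicate n a ++ a ∷ xs ≡ a ∷ replicate n a ++ xs
replicate-++-∷ zero    a xs = refl
replicate-++-∷ (suc n) a xs = cong (a ∷_) (replicate-++-∷ n a xs)

reverse-replicate : ∀ {A : Set} n (a : A) → reverse (replicate n a) ≡ replicate n a
reverse-replicate zero    a = refl
reverse-replicate (suc n) a = begin
  reverse (a ∷ replicate n a)       ≡⟨ unfold-reverse a (replicate n a) ⟩
  reverse (replicate n a) ++ a ∷ [] ≡⟨ cong (_++ a ∷ []) (reverse-replicate n a) ⟩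
  replicate n a ++ a ∷ []           ≡⟨ replicate-++-∷ n a [] ⟩
  a ∷ replicate n a ++ []           ≡⟨ cong (a ∷_) (++-identityʳ (replicate n a)) ⟩
  a ∷ replicate n a                 ∎
  where open ≡-Reasoning

replicate-2*suc : ∀ {A : Set} n (a : A) → replicate (2 * suc n) a ≡ a ∷ a ∷ replicate (2 * n) a
replicate-2*suc n a = cong (λ m → replicate m a) (*-suc 2 n)

-- A record rather than the bare equation, so that c, t and d stay inferable.
infix 4 _↠⟨_⟩_
record _↠⟨_⟩_ (c : Config) (t : ℕ) (d : Config) : Set where
  constructor computed
  field runs-to : run t c ≡ just d
open _↠⟨_⟩_

↠-cast : ∀ {c d d' t t'} → c ↠⟨ t ⟩ d → t ≡ t' → d ≡ d' → c ↠⟨ t' ⟩ d'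
↠-cast p refl refl = p

↠-from : ∀ {c c' d t} → c ≡ c' → c' ↠⟨ t ⟩ d → c ↠⟨ t ⟩ d
↠-from refl p = p

run-+ : ∀ t s c → run (t + s) c ≡ (run t c >>= run s)
run-+ zero    s c = refl
run-+ (suc t) s c with step c
... | nothing = refl
... | just c' = run-+ t s c'

infixr 5 _▹_
_▹_ : ∀ {c d e t s} → c ↠⟨ t ⟩ d → d ↠⟨ s ⟩ e → c ↠⟨ t + s ⟩ e
_▹_ {c} {t = t} {s} p q = computed (trans (run-+ t s c) (trans (cong (_>>= run s) (runs-to p)) (runs-to q)))

cfgʳ : List Sym → St → List Sym → Config
cfgʳ l q []      = cfg l q s0 []
cfgʳ l q (x ∷ r) = cfg l q x r

cfgˡ : List Sym → St → List Sym → Config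
cfgˡ []      q r = cfg [] q s0 r
cfgˡ (x ∷ l) q r = cfg l q x r

step-by : ∀ {q a b D q' l r} → δ q a ≡ just (b , D , q') → cfg l q a r ↠⟨ 1 ⟩ move b D q' l r
step-by {q} {a} {l = l} {r} eq = computed (cong (_>>= just) (step-cfg eq))
  where
  step-cfg : ∀ {b D q'} → δ q a ≡ just (b , D , q') → step (cfg l q a r) ≡ just (move b D q' l r)
  step-cfg eq with δ q a
  step-cfg refl | _ = refl

step-R : ∀ {q a b q' l r} → δ q a ≡ just (b , R , q') → cfg l q a r ↠⟨ 1 ⟩ cfgʳ (b ∷ l) q' r
step-R {r = []}    eq = step-by eq
step-R {r = _ ∷ _} eq = step-by eq

step-L : ∀ {q a b q' l r} → δ q a ≡ just (b , L , q') → cfg l q a r ↠⟨ 1 ⟩ cfgˡ l q' (b ∷ r)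
step-L {l = []}    eq = step-by eq
step-L {l = _ ∷ _} eq = step-by eq

sweepʳ : ∀ {q a b} → δ q a ≡ just (b , R , q) →
         ∀ n l r → cfgʳ l q (replicate n a ++ r) ↠⟨ n ⟩ cfgʳ (replicate n b ++ l) q r
sweepʳ         eq zero    l r = computed refl
sweepʳ {q} {b = b} eq (suc n) l r =
  ↠-cast (step-R eq ▹ sweepʳ eq n (b ∷ l) r) refl (cong (λ l' → cfgʳ l' q r) (replicate-++-∷ n b l))

sweepˡ : ∀ {q a b} → δ q a ≡ just (b , L , q) →
         ∀ n l r → cfgˡ (replicate n a ++ l) q r ↠⟨ n ⟩ cfgˡ l q (replicate n b ++ r)
sweepˡ         eq zero    l r = computed refl
sweepˡ {q} {b = b} eq (suc n) l r =
  ↠-cast (step-L eq ▹ sweepˡ eq n l (b ∷ r)) refl (cong (cfgˡ l q) (replicate-++-∷ n b r))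

-- The 2s to the right of the head, followed by the blank the machine last wrote there.
twos : ℕ → List Sym
twos n = replicate n s2 ++ s0 ∷ []

append-two : ∀ n l → cfgʳ l A (twos n) ↠⟨ 2 * n + 3 ⟩ cfgˡ l A (twos (suc n))
append-two n l =
  ↠-cast (sweepʳ refl n l (s0 ∷ []) ▹ step-R refl ▹ step-L refl ▹ sweepˡ refl (suc n) l (s0 ∷ []))
    (solve (n ∷ [])) refl

pair⇒triple : ∀ m X → cfg (s3 ∷ s3 ∷ X) A s4 (twos m) ↠⟨ 2 * m + 10 ⟩ cfg X A s4 (twos (3 + m))
pair⇒triple m X = ↠-cast (computed {t = 3} refl ▹ append-two (2 + m) (s4 ∷ X)) (solve (m ∷ [])) refl

pairs⇒triples : ∀ j m X →
  cfg (replicate (2 * j) s3 ++ X) A s4 (twos m) ↠⟨ j * (3 * j + 2 * m + 7) ⟩ cfg X A s4 (twos (3 * j + m))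
pairs⇒triples zero    m X = computed refl
pairs⇒triples (suc j) m X =
  ↠-from (cong (λ Y → cfg (Y ++ X) A s4 (twos m)) (replicate-2*suc j s3))
  (↠-cast (pair⇒triple m _ ▹ pairs⇒triples j (3 + m) X)
    (solve (j ∷ m ∷ [])) (cong (λ n → cfg X A s4 (twos n)) (regroup j m)))
  where regroup : ∀ j m → 3 * j + (3 + m) ≡ 3 * suc j + m
        regroup = solve-∀

-- The first 8 steps turn the rightmost pair of 3s into a 4 followed by two 2s; from then on
-- the 4 separates the 3s still to be read from the 2s already written.
threes⇒twos : ∀ k X →
  cfg (replicate (2 * k) s3 ++ X) B s0 [] ↠⟨ 3 * k * k + 5 * k + 1 ⟩ cfgˡ X A (twos (3 * k))
threes⇒twos zero    X = step-L refl
threes⇒twos (suc j) X =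
  ↠-from (cong (λ Y → cfg (Y ++ X) B s0 []) (replicate-2*suc j s3))
  (↠-cast (computed {t = 8} refl ▹ pairs⇒triples j 2 X ▹ step-L refl)
    (solve (j ∷ [])) (cong (λ n → cfgˡ X A (twos n)) (regroup j)))
  where regroup : ∀ j → suc (3 * j + 2) ≡ 3 * suc j
        regroup = solve-∀

conf-threes : ∀ P n → conf (P ++ replicate n s3) B s0 [] ≡ cfg (replicate n s3 ++ reverse P) B s0 []
conf-threes P n = cong (λ l → cfg l B s0 [])
  (trans (reverse-++ P (replicate n s3)) (cong (_++ reverse P) (reverse-replicate n s3)))

even-entry : ∀ k P →
  conf (P ++ replicate (2 * k) s3) B s0 [] ↠⟨ 3 * k * k + 5 * k + 1 ⟩ cfgˡ (reverse P) A (twos (3 * k))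
even-entry k P = ↠-from (conf-threes P (2 * k)) (threes⇒twos k (reverse P))

odd-entry : ∀ k P →
  conf (P ++ replicate (2 * k + 1) s3) B s0 [] ↠⟨ 3 * k * k + 5 * k + 1 ⟩ cfg (reverse P) A s3 (twos (3 * k))
odd-entry k P =
  ↠-from (trans (conf-threes P (2 * k + 1)) (cong (λ l → cfg l B s0 []) odd-block))
    (threes⇒twos k (s3 ∷ reverse P))
  where
  odd-block : replicate (2 * k + 1) s3 ++ reverse P ≡ replicate (2 * k) s3 ++ s3 ∷ reverse P
  odd-block = trans (cong (λ n → replicate n s3 ++ reverse P) (+-comm (2 * k) 1))
                    (sym (replicate-++-∷ (2 * k) s3 (reverse P)))

twos⇒threes : ∀ P n → cfgʳ (reverse P) B (twos n) ↠⟨ n ⟩ conf (P ++ replicate n s3) B s0 []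
twos⇒threes P n = ↠-cast (sweepʳ refl n (reverse P) (s0 ∷ [])) refl (sym (conf-threes P n))

restart : ∀ n → cfg [] A s0 (twos n) ↠⟨ 1 + n ⟩ C n 1
restart n = step-R refl ▹ twos⇒threes (s1 ∷ []) n

↠⇒⊢ : ∀ {c d t} → c ↠⟨ t ⟩ d → c ⊢⟨ t ⟩ d
↠⇒⊢ p = cong (map normalize) (runs-to p)

C-even-1 : ∀ k → C (2 * k) 1 ↠⟨ 3 * k * k + 8 * k + 4 ⟩ C (3 * k + 1) 1
C-even-1 k = ↠-cast (even-entry k (s1 ∷ []) ▹ step-L refl ▹ restart (1 + 3 * k))
  (solve (k ∷ [])) (cong (λ n → C n 1) (+-comm 1 (3 * k)))

C-even-2 : ∀ k → C (2 * k) 2 ↠⟨ 3 * k * k + 14 * k + 9 ⟩ C (3 * k + 2) 1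
C-even-2 k = ↠-cast (even-entry k (s2 ∷ []) ▹ append-two (1 + 3 * k) [] ▹ restart (2 + 3 * k))
  (solve (k ∷ [])) (cong (λ n → C n 1) (+-comm 2 (3 * k)))

C-even-3 : ∀ k → C (2 * k) 3 ↠⟨ 3 * k * k + 8 * k + 2 ⟩ C (3 * k) 1
C-even-3 k = ↠-cast (even-entry k [] ▹ restart (3 * k)) (solve (k ∷ [])) refl

C-even-4 : ∀ k → C (2 * k) 4 ↠⟨ 3 * k * k + 8 * k + 8 ⟩ C (3 * k + 3) 1
C-even-4 k = ↠-cast (even-entry k (s4 ∷ s1 ∷ s1 ∷ []) ▹ computed {t = 3} refl ▹ restart (3 + 3 * k))
  (solve (k ∷ [])) (cong (λ n → C n 1) (+-comm 3 (3 * k)))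

C-even-5 : ∀ k → C (2 * k) 5 ↠⟨ 3 * k * k + 14 * k + 13 ⟩ C (3 * k + 4) 1
C-even-5 k =
  ↠-cast (even-entry k (s4 ∷ s1 ∷ s2 ∷ []) ▹ append-two (1 + 3 * k) (s1 ∷ s4 ∷ [])
          ▹ computed {t = 2} refl ▹ restart (4 + 3 * k))
    (solve (k ∷ [])) (cong (λ n → C n 1) (+-comm 4 (3 * k)))

C-even-6 : ∀ k → C (2 * k) 6 ↠⟨ 3 * k * k + 8 * k + 6 ⟩ C (3 * k + 2) 1
C-even-6 k = ↠-cast (even-entry k (s4 ∷ s1 ∷ []) ▹ computed {t = 2} refl ▹ restart (2 + 3 * k))
  (solve (k ∷ [])) (cong (λ n → C n 1) (+-comm 2 (3 * k)))

C-even-7 : ∀ k → C (2 * k) 7 ↠⟨ 3 * k * k + 14 * k + 11 ⟩ C (3 * k + 3) 1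
C-even-7 k =
  ↠-cast (even-entry k (s4 ∷ s2 ∷ []) ▹ append-two (1 + 3 * k) (s4 ∷ [])
          ▹ computed {t = 1} refl ▹ restart (3 + 3 * k))
    (solve (k ∷ [])) (cong (λ n → C n 1) (+-comm 3 (3 * k)))

C-even-8 : ∀ k → C (2 * k) 8 ↠⟨ 3 * k * k + 8 * k + 4 ⟩ C (3 * k + 1) 1
C-even-8 k = ↠-cast (even-entry k (s4 ∷ []) ▹ computed {t = 1} refl ▹ restart (1 + 3 * k))
  (solve (k ∷ [])) (cong (λ n → C n 1) (+-comm 1 (3 * k)))

C-odd-1 : ∀ k → C (2 * k + 1) 1 ↠⟨ 3 * k * k + 8 * k + 4 ⟩ C (3 * k + 1) 2
C-odd-1 k = ↠-cast (odd-entry k (s1 ∷ []) ▹ computed {t = 2} refl ▹ twos⇒threes (s2 ∷ []) (1 + 3 * k))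
  (solve (k ∷ [])) (cong (λ n → C n 2) (+-comm 1 (3 * k)))

C-odd-2 : ∀ k → C (2 * k + 1) 2 ↠⟨ 3 * k * k + 8 * k + 4 ⟩ C (3 * k + 2) 3
C-odd-2 k = ↠-cast (odd-entry k (s2 ∷ []) ▹ computed {t = 1} refl ▹ twos⇒threes [] (2 + 3 * k))
  (solve (k ∷ [])) (cong (λ n → C n 3) (+-comm 2 (3 * k)))

C-odd-3 : ∀ k → C (2 * k + 1) 3 ↠⟨ 3 * k * k + 8 * k + 22 ⟩ C (3 * k + 1) 4
C-odd-3 k =
  ↠-cast (odd-entry k [] ▹ computed {t = 20} refl ▹ twos⇒threes (s4 ∷ s1 ∷ s1 ∷ []) (1 + 3 * k))
    (solve (k ∷ [])) (cong (λ n → C n 4) (+-comm 1 (3 * k)))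

C-odd-4 : ∀ k → C (2 * k + 1) 4 ↠⟨ 3 * k * k + 8 * k + 4 ⟩ C (3 * k + 1) 5
C-odd-4 k =
  ↠-cast (odd-entry k (s4 ∷ s1 ∷ s1 ∷ []) ▹ computed {t = 2} refl ▹ twos⇒threes (s4 ∷ s1 ∷ s2 ∷ []) (1 + 3 * k))
    (solve (k ∷ [])) (cong (λ n → C n 5) (+-comm 1 (3 * k)))

C-odd-5 : ∀ k → C (2 * k + 1) 5 ↠⟨ 3 * k * k + 8 * k + 4 ⟩ C (3 * k + 2) 6
C-odd-5 k =
  ↠-cast (odd-entry k (s4 ∷ s1 ∷ s2 ∷ []) ▹ computed {t = 1} refl ▹ twos⇒threes (s4 ∷ s1 ∷ []) (2 + 3 * k))
    (solve (k ∷ [])) (cong (λ n → C n 6) (+-comm 2 (3 * k)))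

C-odd-6 : ∀ k → C (2 * k + 1) 6 ↠⟨ 3 * k * k + 8 * k + 4 ⟩ C (3 * k + 1) 7
C-odd-6 k =
  ↠-cast (odd-entry k (s4 ∷ s1 ∷ []) ▹ computed {t = 2} refl ▹ twos⇒threes (s4 ∷ s2 ∷ []) (1 + 3 * k))
    (solve (k ∷ [])) (cong (λ n → C n 7) (+-comm 1 (3 * k)))

C-odd-7 : ∀ k → C (2 * k + 1) 7 ↠⟨ 3 * k * k + 8 * k + 4 ⟩ C (3 * k + 2) 8
C-odd-7 k =
  ↠-cast (odd-entry k (s4 ∷ s2 ∷ []) ▹ computed {t = 1} refl ▹ twos⇒threes (s4 ∷ []) (2 + 3 * k))
    (solve (k ∷ [])) (cong (λ n → C n 8) (+-comm 2 (3 * k)))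

C-odd-8 : ∀ k → C (2 * k + 1) 8 ↠⟨ 3 * k * k + 5 * k + 3 ⟩ cfg (s1 ∷ []) H s2 (twos (3 * k))
C-odd-8 k = ↠-cast (odd-entry k (s4 ∷ []) ▹ computed {t = 2} refl) (solve (k ∷ [])) refl

strip-twos : ∀ n → strip (twos n) ≡ strip (replicate n s2)
strip-twos zero    = refl
strip-twos (suc n) = cong (s2 ∷_) (strip-twos n)

theorem5p1 : (conf [] A s0 [] ⊢⟨ 1 ⟩ C 0 1)
    × (∀ (k : ℕ) →
        (C (2 * k) 1 ⊢⟨ 3 * k * k + 8 * k + 4 ⟩ C (3 * k + 1) 1)
      × (C (2 * k) 2 ⊢⟨ 3 * k * k + 14 * k + 9 ⟩ C (3 * k + 2) 1)
      × (C (2 * k) 3 ⊢⟨ 3 * k * k + 8 * k + 2 ⟩ C (3 * k) 1)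
      × (C (2 * k) 4 ⊢⟨ 3 * k * k + 8 * k + 8 ⟩ C (3 * k + 3) 1)
      × (C (2 * k) 5 ⊢⟨ 3 * k * k + 14 * k + 13 ⟩ C (3 * k + 4) 1)
      × (C (2 * k) 6 ⊢⟨ 3 * k * k + 8 * k + 6 ⟩ C (3 * k + 2) 1)
      × (C (2 * k) 7 ⊢⟨ 3 * k * k + 14 * k + 11 ⟩ C (3 * k + 3) 1)
      × (C (2 * k) 8 ⊢⟨ 3 * k * k + 8 * k + 4 ⟩ C (3 * k + 1) 1)
      × (C (2 * k + 1) 1 ⊢⟨ 3 * k * k + 8 * k + 4 ⟩ C (3 * k + 1) 2)
      × (C (2 * k + 1) 2 ⊢⟨ 3 * k * k + 8 * k + 4 ⟩ C (3 * k + 2) 3)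
      × (C (2 * k + 1) 3 ⊢⟨ 3 * k * k + 8 * k + 22 ⟩ C (3 * k + 1) 4)
      × (C (2 * k + 1) 4 ⊢⟨ 3 * k * k + 8 * k + 4 ⟩ C (3 * k + 1) 5)
      × (C (2 * k + 1) 5 ⊢⟨ 3 * k * k + 8 * k + 4 ⟩ C (3 * k + 2) 6)
      × (C (2 * k + 1) 6 ⊢⟨ 3 * k * k + 8 * k + 4 ⟩ C (3 * k + 1) 7)
      × (C (2 * k + 1) 7 ⊢⟨ 3 * k * k + 8 * k + 4 ⟩ C (3 * k + 2) 8)
      × (C (2 * k + 1) 8 ⊢⟨ 3 * k * k + 5 * k + 3 ⟩ conf (s1 ∷ []) H s2 (replicate (3 * k) s2)))
theorem5p1 = refl , λ k →
  ↠⇒⊢ (C-even-1 k) , ↠⇒⊢ (C-even-2 k) , ↠⇒⊢ (C-even-3 k) , ↠⇒⊢ (C-even-4 k) ,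
  ↠⇒⊢ (C-even-5 k) , ↠⇒⊢ (C-even-6 k) , ↠⇒⊢ (C-even-7 k) , ↠⇒⊢ (C-even-8 k) ,
  ↠⇒⊢ (C-odd-1 k) , ↠⇒⊢ (C-odd-2 k) , ↠⇒⊢ (C-odd-3 k) , ↠⇒⊢ (C-odd-4 k) ,
  ↠⇒⊢ (C-odd-5 k) , ↠⇒⊢ (C-odd-6 k) , ↠⇒⊢ (C-odd-7 k) ,
  trans (↠⇒⊢ (C-odd-8 k)) (cong (λ r → just (cfg (s1 ∷ []) H s2 r)) (strip-twos (3 * k)))
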